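{- Let $G_0, G_1, G_2$ be finite graphs, each with a distinguished vertex $A$, such that for each $j\in\{0,1,2\}$ the sages win the hat guessing game on $G_j$ with the hint $A-1$. Let $G$ be the graph obtained from the disjoint union of $G_0$, $G_1$, $G_2$ and a single edge $P_2(AB)$ by identifying the distinguished vertices of $G_0,G_1,G_2$ and the endpoint $A$ of the edge into one vertex $A$ (so $B$ is a leaf adjacent to $A$). Then the sages win the hat guessing game on $G$ without any hints.
   Context: Hat guessing game: a sage sits at each vertex of a finite graph; hat colors are $H=\{0,1,2\}$; each sage sees only his neighbours' hats and guesses his own color by a deterministic function of the neighbours' colors, fixed in advance; a strategy is winning if for every hat placement at least one sage guesses correctly. Hint $A-1$: a color $i\in H$ is announced in advance to everyone and only placements $C$ with $C(A)\ne i$ occur; the sages win with this hint if for every announced $i$ there is a strategy such that every placement with $C(A)\ne i$ has a correct guess (by permuting color names, equivalent to this for a single $i$). -}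

module Defs where

open import Data.Nat using (ℕ)
open import Data.Fin using (Fin)
open import Data.Product using (Σ; ∃; _×_; proj₁)
open import Function.Bundles using (_↔_)
open import Relation.Binary.PropositionalEquality using (_≡_)
open import Relation.Nullary using (¬_)

Colour : Set
Colour = Fin 3

record Graph : Set₁ where
  field
    V     : Set
    size  : ℕ
    fin   : V ↔ Fin size
    Adj   : V → V → Set
    sym   : ∀ {v w} → Adj v w → Adj w v
    irrefl : ∀ {v} → ¬ Adj v v

record PointedGraph : Set₁ where
  field
    graph : Graph
  open Graph graph public
  field
    A : V

module _ (V : Set) (Adj : V → V → Set) where

  Placement : Set
  Placement = V → Colour

  Strategy : Set
  Strategy = Σ (V → Placement → Colour) λ f →
    ∀ v (c c′ : Placement) → (∀ w → Adj v w → c w ≡ c′ w) → f v c ≡ f v c′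

  guess : Strategy → V → Placement → Colour
  guess s = proj₁ s

  SomeoneCorrect : Strategy → Placement → Set
  SomeoneCorrect s c = ∃ λ v → guess s v c ≡ c v

  Wins : Set
  Wins = Σ Strategy λ s → ∀ c → SomeoneCorrect s c

  -- sages win with hint "A - 1" at vertex A: for every announced colour i
  -- there is a strategy correct on all placements with C(A) ≠ i.
  WinsWithHint : V → Set
  WinsWithHint A = ∀ (i : Colour) → Σ Strategy λ s →
    ∀ c → ¬ (c A ≡ i) → SomeoneCorrect s c

module Glue (G : Fin 3 → PointedGraph) where
  open PointedGraph

  data GV : Set where
    hubA  : GV
    leafB : GV
    inner : (j : Fin 3) → Σ (V (G j)) (λ v → ¬ (v ≡ A (G j))) → GV

  data GAdj : GV → GV → Set where
    in-in : ∀ j {v w} → Adj (G j) (proj₁ v) (proj₁ w) → GAdj (inner j v) (inner j w)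
    in-A  : ∀ j {v} → Adj (G j) (proj₁ v) (A (G j)) → GAdj (inner j v) hubA
    A-in  : ∀ j {v} → Adj (G j) (A (G j)) (proj₁ v) → GAdj hubA (inner j v)
    A-B   : GAdj hubA leafB
    B-A   : GAdj leafB hubA

-- B guesses the colour of A. A sees the colour b of B and plays, at A, the
-- strategy that wins on G_b under the hint "C(A) ≠ b"; each inner vertex of
-- G_j always plays the hint-j strategy of G_j. If B is wrong, then C(A) ≠ b,
-- so on G_b the placement obeys the hint of the strategy being played there,
-- and some sage of G_b (possibly A) guesses correctly.
module Submission where

open import Defs
open import Data.Fin using (Fin; _≟_)
open import Data.Fin.Properties using (inj⇒≟)
open import Data.Product using (_,_; proj₁; proj₂)
open import Function using (_∘_)
open import Function.Properties.Inverse using (↔⇒↣)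
open import Relation.Binary.PropositionalEquality using (_≡_; _≢_; refl; sym; trans; cong)
open import Relation.Binary.Definitions using (DecidableEquality)
open import Relation.Nullary using (yes; no)
open import Data.Empty using (⊥-elim)

module Glued (G : Fin 3 → PointedGraph) where
  open PointedGraph
  open Glue G

  vertex-≟ : ∀ j → DecidableEquality (V (G j))
  vertex-≟ j = inj⇒≟ (↔⇒↣ (fin (G j)))

  embed : ∀ j → V (G j) → GV
  embed j x with vertex-≟ j x (A (G j))
  ... | yes _  = hubA
  ... | no x≢A = inner j (x , x≢A)

  embed-A : ∀ j → embed j (A (G j)) ≡ hubA
  embed-A j with vertex-≟ j (A (G j)) (A (G j))
  ... | yes _  = refl
  ... | no A≢A = ⊥-elim (A≢A refl)

  data LiesOver (j : Fin 3) : GV → V (G j) → Set where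
    hub-over   : LiesOver j hubA (A (G j))
    inner-over : ∀ {x} (x≢A : x ≢ A (G j)) → LiesOver j (inner j (x , x≢A)) x

  embed-adj : ∀ {j u x y} → LiesOver j u x → Adj (G j) x y → GAdj u (embed j y)
  embed-adj {j} {y = y} over xy with vertex-≟ j y (A (G j))
  embed-adj hub-over       Ay | yes refl = ⊥-elim (irrefl (G _) Ay)
  embed-adj (inner-over _) xy | yes refl = in-A _ xy
  embed-adj hub-over       Ay | no _     = A-in _ Ay
  embed-adj (inner-over _) xy | no _     = in-in _ xy

  play : ∀ j → Strategy (V (G j)) (Adj (G j)) → V (G j) → Placement GV GAdj → Colour
  play j s x c = guess (V (G j)) (Adj (G j)) s x (c ∘ embed j)

  play-local : ∀ {j u x} (s : Strategy (V (G j)) (Adj (G j))) → LiesOver j u x →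
    ∀ c c′ → (∀ z → GAdj u z → c z ≡ c′ z) → play j s x c ≡ play j s x c′
  play-local {x = x} s over c c′ agree =
    proj₂ s x (c ∘ embed _) (c′ ∘ embed _) (λ y xy → agree (embed _ y) (embed-adj over xy))

  module Strategies (S : ∀ j → Strategy (V (G j)) (Adj (G j))) where

    glued-guess : GV → Placement GV GAdj → Colour
    glued-guess hubA              c = play (c leafB) (S (c leafB)) (A (G (c leafB))) c
    glued-guess leafB             c = c hubA
    glued-guess (inner j (x , _)) c = play j (S j) x c

    glued-local : ∀ v c c′ → (∀ z → GAdj v z → c z ≡ c′ z) → glued-guess v c ≡ glued-guess v c′
    glued-local hubA c c′ agree rewrite agree leafB A-B =
      play-local (S (c′ leafB)) hub-over c c′ agree
    glued-local leafB c c′ agree = agree hubA B-A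
    glued-local (inner j (x , x≢A)) c c′ agree = play-local (S j) (inner-over x≢A) c c′ agree

    glued : Strategy GV GAdj
    glued = glued-guess , glued-local

    glued-guess-embed : ∀ c x → glued-guess (embed (c leafB) x) c ≡ play (c leafB) (S (c leafB)) x c
    glued-guess-embed c x with vertex-≟ (c leafB) x (A (G (c leafB)))
    ... | yes refl = refl
    ... | no _     = refl

theorem11 : (G : Fin 3 → PointedGraph) →
    (∀ j → WinsWithHint (PointedGraph.V (G j)) (PointedGraph.Adj (G j)) (PointedGraph.A (G j))) →
    Wins (Glue.GV G) (Glue.GAdj G)
theorem11 G wins-with-hint = glued , someone-correct
  where
  open Glue G
  open Glued G
  open Strategies (λ j → proj₁ (wins-with-hint j j))

  someone-correct : ∀ c → SomeoneCorrect GV GAdj glued c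
  someone-correct c with c leafB ≟ c hubA
  ... | yes B≡A = leafB , sym B≡A
  ... | no B≢A with proj₂ (wins-with-hint (c leafB) (c leafB)) (c ∘ embed (c leafB))
                     (λ A≡B → B≢A (sym (trans (sym (cong c (embed-A (c leafB)))) A≡B)))
  ... | x , correct = embed (c leafB) x , trans (glued-guess-embed c x) correct
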